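{- Let $G=(V,E)$ be a strongly connected directed graph, let $B$ be the set of strong articulation points of $G$, and let $$T^{ap}=B\cup\{x\in V\setminus B : \text{the underlying undirected graph of } G\setminus\{x\} \text{ is not } 2\text{ -edge-connected}\}.$$ Then for every $y\in V$, the vertex $y$ is a twinless articulation point of $G$ if and only if $y\in T^{ap}$.
   Context: Directed graphs $G=(V,E)$ are finite with $E\subseteq V\times V$ (no loops, no parallel edges). For $x\in V$, $G\setminus\{x\}$ is the subgraph induced by $V\setminus\{x\}$. A directed graph is twinless strongly connected if for every pair of vertices $a,b$ there is a directed path $p$ from $a$ to $b$ and a directed path $q$ from $b$ to $a$ such that for every edge $(c,d)$ of $p$, the edge $(d,c)$ is not an edge of $q$. A strong articulation point of $G$ is a vertex $v$ such that $G\setminus\{v\}$ is not strongly connected. A twinless articulation point of $G$ is a vertex $v$ such that $G\setminus\{v\}$ is not twinless strongly connected. The underlying undirected graph of a directed graph $(V,E)$ is the simple undirected graph on $V$ in which $\{a,b\}$ is an edge iff $(a,b)\in E$ or $(b,a)\in E$. An undirected graph is $2$-edge-connected if it is connected and remains connected after deleting any single edge. -}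

module Defs where

open import Data.Nat using (ℕ)
open import Data.Fin using (Fin)
open import Data.Bool using (Bool; true)
open import Data.Product using (Σ; ∃; _×_; _,_)
open import Data.Sum using (_⊎_)
open import Data.Unit using (⊤)
open import Data.List using (List; []; _∷_)
open import Data.List.Membership.Propositional using (_∈_; _∉_)
open import Data.List.Relation.Unary.Unique.Propositional using (Unique)
open import Relation.Nullary using (¬_)
open import Relation.Binary.PropositionalEquality using (_≡_; _≢_)

-- A finite directed graph on vertex set V = Fin n, given by a (decidable,
-- Bool-valued) adjacency relation; E ⊆ V × V, no loops, no parallel edges.
record Digraph (n : ℕ) : Set where
  field
    adj    : Fin n → Fin n → Bool
    noLoop : ∀ x → ¬ (adj x x ≡ true)

open Digraph public

module _ {n : ℕ} where

  Edge : Digraph n → Fin n → Fin n → Set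
  Edge G a b = adj G a b ≡ true

  -- vertex sets (for induced subgraphs) are predicates on Fin n
  VSet : Set₁
  VSet = Fin n → Set

  allV : VSet
  allV _ = ⊤

  minus : Fin n → VSet
  minus x v = v ≢ x

  data Walk (R : Fin n → Fin n → Set) (S : VSet) : Fin n → Fin n → Set where
    []  : ∀ {a} → S a → Walk R S a a
    _∷_ : ∀ {a b c} → S a × R a b → Walk R S b c → Walk R S a c

  vertices : ∀ {R S a b} → Walk R S a b → List (Fin n)
  vertices {a = a} ([] _) = a ∷ []
  vertices {a = a} (_ ∷ w) = a ∷ vertices w

  edges : ∀ {R S a b} → Walk R S a b → List (Fin n × Fin n)
  edges ([] _) = []
  edges {a = a} (_∷_ {b = b} _ w) = (a , b) ∷ edges w

  record Path (R : Fin n → Fin n → Set) (S : VSet) (a b : Fin n) : Set where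
    constructor path
    field
      walk     : Walk R S a b
      distinct : Unique (vertices walk)
  open Path public

  StronglyConnected : Digraph n → VSet → Set
  StronglyConnected G S = ∀ a b → S a → S b → Path (Edge G) S a b

  TwinlessStronglyConnected : Digraph n → VSet → Set
  TwinlessStronglyConnected G S =
    ∀ a b → S a → S b →
      Σ (Path (Edge G) S a b) λ p → Σ (Path (Edge G) S b a) λ q →
        ∀ c d → (c , d) ∈ edges (walk p) → (d , c) ∉ edges (walk q)

  StrongArticulationPoint : Digraph n → Fin n → Set
  StrongArticulationPoint G v = ¬ StronglyConnected G (minus v)

  TwinlessArticulationPoint : Digraph n → Fin n → Set
  TwinlessArticulationPoint G v = ¬ TwinlessStronglyConnected G (minus v)

  UEdge : Digraph n → Fin n → Fin n → Set
  UEdge G a b = Edge G a b ⊎ Edge G b a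

  Connected : VSet → (Fin n → Fin n → Set) → Set
  Connected S U = ∀ a b → S a → S b → Walk U S a b

  deleteEdge : (Fin n → Fin n → Set) → Fin n → Fin n → Fin n → Fin n → Set
  deleteEdge U u v a b = U a b × ¬ ((a ≡ u × b ≡ v) ⊎ (a ≡ v × b ≡ u))

  TwoEdgeConnected : VSet → (Fin n → Fin n → Set) → Set
  TwoEdgeConnected S U =
    Connected S U ×
    (∀ u v → S u → S v → U u v → Connected S (deleteEdge U u v))

  InTap : Digraph n → Fin n → Set
  InTap G x = StrongArticulationPoint G x
            ⊎ (¬ StrongArticulationPoint G x × ¬ TwoEdgeConnected (minus x) (UEdge G))

module Submission where

-- The theorem is an instance of a characterisation of twinless strong
-- connectivity (due to Raghavan): the subgraph of G induced by a decidable
-- vertex set S is twinless strongly connected iff it is strongly connected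
-- and its underlying undirected graph is 2-edge-connected.  Applied to
-- S = V ∖ {y} it says exactly that y is a twinless articulation point iff
-- y ∈ T^ap.

open import Defs
open import Level using (0ℓ)
open import Data.Nat using (ℕ; zero; suc; _≤_; z≤n; s≤s)
open import Data.Fin using (Fin; zero; suc; _≟_)
open import Data.Fin.Properties using (any?; all?; injective⇒≤)
open import Data.Bool using (true)
open import Data.Bool.Properties using () renaming (_≟_ to _≟ᵇ_)
open import Data.Product using (Σ; ∃; _×_; _,_; proj₁; proj₂)
open import Data.Sum using (_⊎_; inj₁; inj₂; swap; [_,_]′)
open import Data.Empty using (⊥; ⊥-elim)
open import Data.List using (List; []; _∷_; length; lookup; allFin; cartesianProduct)
open import Data.List.Membership.Propositional using (_∈_)
open import Data.List.Membership.Propositional.Properties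
  using (∈-lookup; ∈-allFin; ∈-cartesianProduct⁺)
open import Data.List.Relation.Unary.Any as Any using (here; there)
open import Data.List.Relation.Unary.All as All using ([]; _∷_)
open import Data.List.Relation.Unary.All.Properties using (¬Any⇒All¬)
open import Data.List.Relation.Unary.AllPairs using ([]; _∷_)
open import Data.List.Relation.Unary.Unique.Propositional using (Unique)
open import Relation.Nullary using (¬_; Dec; yes; no)
open import Relation.Nullary.Decidable using (¬?; _×-dec_; _⊎-dec_; _→-dec_; map′)
open import Relation.Unary as U using ()
open import Relation.Binary.Core using (Rel)
open import Relation.Binary.Definitions using (Decidable; Symmetric)
open import Relation.Binary.PropositionalEquality using (_≡_; _≢_; refl; sym; cong; subst)
open import Function using (id; _∘_)
open import Function.Bundles using (_⇔_; mk⇔; Equivalence)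

module _ {n : ℕ} where

  private variable
    R Q : Rel (Fin n) 0ℓ
    S : Fin n → Set
    a b c d u v x y z : Fin n

  start∈ : Walk R S a b → S a
  start∈ ([] s) = s
  start∈ ((s , _) ∷ _) = s

  _++ʷ_ : Walk R S a b → Walk R S b c → Walk R S a c
  [] _ ++ʷ w′ = w′
  (arc ∷ w) ++ʷ w′ = arc ∷ (w ++ʷ w′)

  bindʷ : (∀ {x y} → S x → S y → R x y → Walk Q S x y) → Walk R S a b → Walk Q S a b
  bindʷ f ([] s) = [] s
  bindʷ f ((s , r) ∷ w) = f s (start∈ w) r ++ʷ bindʷ f w

  mapʷ : (∀ {x y} → S x → S y → R x y → Q x y) → Walk R S a b → Walk Q S a b
  mapʷ f ([] s) = [] s
  mapʷ f ((s , r) ∷ w) = (s , f s (start∈ w) r) ∷ mapʷ f w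

  vertices-mapʷ : (f : ∀ {x y} → S x → S y → R x y → Q x y) (w : Walk R S a b) →
                  vertices (mapʷ f w) ≡ vertices w
  vertices-mapʷ f ([] s) = refl
  vertices-mapʷ f (_ ∷ w) = cong (_ ∷_) (vertices-mapʷ f w)

  edges-mapʷ : (f : ∀ {x y} → S x → S y → R x y → Q x y) (w : Walk R S a b) →
               edges (mapʷ f w) ≡ edges w
  edges-mapʷ f ([] s) = refl
  edges-mapʷ f (_ ∷ w) = cong (_ ∷_) (edges-mapʷ f w)

  reverseʷ : Symmetric R → Walk R S a b → Walk R S b a
  reverseʷ R-sym ([] s) = [] s
  reverseʷ R-sym ((s , r) ∷ w) = reverseʷ R-sym w ++ʷ ((start∈ w , R-sym r) ∷ [] s)

  edge-inside : (w : Walk R S a b) → (c , d) ∈ edges w → S c × R c d × S d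
  edge-inside ((s , r) ∷ w) (here refl) = s , r , start∈ w
  edge-inside (_ ∷ w) (there e) = edge-inside w e

  suffixFrom : (w : Walk R S c b) → a ∈ vertices w →
               Σ (Walk R S a b) λ w′ → Unique (vertices w) → Unique (vertices w′)
  suffixFrom ([] s) (here refl) = [] s , id
  suffixFrom (arc ∷ w) (here refl) = arc ∷ w , id
  suffixFrom (_ ∷ w) (there a∈w) with suffixFrom w a∈w
  ... | w′ , unique = w′ , λ { (_ ∷ u) → unique u }

  -- Loop erasure: every walk contains a path with the same ends.  If the
  -- start vertex reappears on the erased rest, continue from there instead.
  toPath : Walk R S a b → Path R S a b
  toPath ([] s) = path ([] s) ([] ∷ [])
  toPath {a = a} (arc ∷ w) with toPath w
  ... | path w′ u′ with Any.any? (a ≟_) (vertices w′)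
  ...   | yes a∈w′ = let (w″ , unique) = suffixFrom w′ a∈w′ in path w″ (unique u′)
  ...   | no a∉w′ = path (arc ∷ w′) (¬Any⇒All¬ _ a∉w′ ∷ u′)

  -- A duplicate-free list of vertices has at most n entries, since indexing
  -- into it is an injection into Fin n.
  lookup-injective : (xs : List (Fin n)) → Unique xs → ∀ i j → lookup xs i ≡ lookup xs j → i ≡ j
  lookup-injective (_ ∷ _) _ zero zero _ = refl
  lookup-injective (_ ∷ xs) (x∉xs ∷ _) zero (suc j) eq =
    ⊥-elim (All.lookup x∉xs (∈-lookup j) eq)
  lookup-injective (_ ∷ xs) (x∉xs ∷ _) (suc i) zero eq =
    ⊥-elim (All.lookup x∉xs (∈-lookup i) (sym eq))
  lookup-injective (_ ∷ xs) (_ ∷ u) (suc i) (suc j) eq = cong suc (lookup-injective xs u i j eq)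

  unique⇒length≤ : (xs : List (Fin n)) → Unique xs → length xs ≤ n
  unique⇒length≤ xs u = injective⇒≤ (lookup-injective xs u _ _)

  -- Reachability is decidable: a walk exists iff one through at most n
  -- vertices does, and the latter are found by a bounded search.

  module _ (R? : Decidable R) (S? : U.Decidable S) where

    ShortWalk : ℕ → Fin n → Fin n → Set
    ShortWalk k a b = Σ (Walk R S a b) λ w → length (vertices w) ≤ k

    shortWalk? : ∀ k a b → Dec (ShortWalk k a b)
    shortWalk? zero a b = no λ { ([] _ , ()) ; (_ ∷ _ , ()) }
    shortWalk? (suc k) a b with S? a | a ≟ b
    ... | no a∉S | _ = no λ (w , _) → a∉S (start∈ w)
    ... | yes a∈S | yes refl = yes ([] a∈S , s≤s z≤n)
    ... | yes a∈S | no a≢b with any? (λ c → R? a c ×-dec shortWalk? k c b)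
    ...   | yes (_ , r , w , short) = yes ((a∈S , r) ∷ w , s≤s short)
    ...   | no noStep = no λ { ([] _ , _) → a≢b refl
                             ; ((_ , r) ∷ w , s≤s short) → noStep (_ , r , w , short) }

    walk? : ∀ a b → Dec (Walk R S a b)
    walk? a b = map′ proj₁ shorten (shortWalk? n a b)
      where
      shorten : Walk R S a b → ShortWalk n a b
      shorten w = let p = toPath w in walk p , unique⇒length≤ _ (distinct p)

  stronglyConnected? : (G : Digraph n) → U.Decidable S → Dec (StronglyConnected G S)
  stronglyConnected? {S = S} G S? =
    map′ (λ walks a b sa sb → toPath (walks a b sa sb))
         (λ sc a b sa sb → walk (sc a b sa sb))
         (all? λ a → all? λ b → S? a →-dec (S? b →-dec walk? E? S? a b))
    where
    E? : Decidable (Edge G)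
    E? a b = adj G a b ≟ᵇ true

  OnEdge : Fin n → Fin n → Fin n → Fin n → Set
  OnEdge u v x y = (x ≡ u × y ≡ v) ⊎ (x ≡ v × y ≡ u)

  onEdge? : ∀ u v x y → Dec (OnEdge u v x y)
  onEdge? u v x y = ((x ≟ u) ×-dec (y ≟ v)) ⊎-dec ((x ≟ v) ×-dec (y ≟ u))

  deleteEdge? : Decidable R → ∀ u v → Decidable (deleteEdge R u v)
  deleteEdge? R? u v x y = R? x y ×-dec ¬? (onEdge? u v x y)

  onEdge-flip : OnEdge u v y x → OnEdge u v x y
  onEdge-flip (inj₁ (y≡u , x≡v)) = inj₂ (x≡v , y≡u)
  onEdge-flip (inj₂ (y≡v , x≡u)) = inj₁ (x≡u , y≡v)

  deleteEdge-sym : Symmetric R → Symmetric (deleteEdge R u v)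
  deleteEdge-sym R-sym (r , notOn) = R-sym r , notOn ∘ onEdge-flip

  deleteEdge-swap : deleteEdge R u v x y → deleteEdge R v u x y
  deleteEdge-swap (r , notOn) = r , notOn ∘ swap

  afterLastUse : ∀ c d (w : Walk R S a z) →
    Walk (deleteEdge R c d) S a z ⊎ Walk (deleteEdge R c d) S c z
      ⊎ ((c , d) ∈ edges w × Walk (deleteEdge R c d) S d z)
  afterLastUse c d ([] s) = inj₁ ([] s)
  afterLastUse {a = a} c d (_∷_ {b = b} (s , r) w) with afterLastUse c d w
  ... | inj₂ (inj₁ w′) = inj₂ (inj₁ w′)
  ... | inj₂ (inj₂ (cd∈w , w′)) = inj₂ (inj₂ (there cd∈w , w′))
  ... | inj₁ w′ with onEdge? c d a b
  ...   | no notOn = inj₁ ((s , r , notOn) ∷ w′)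
  ...   | yes (inj₁ (refl , refl)) = inj₂ (inj₂ (here refl , w′))
  ...   | yes (inj₂ (refl , refl)) = inj₂ (inj₁ w′)

  beforeFirstUse : ∀ c d → Walk R S a z →
    Walk (deleteEdge R c d) S a z ⊎ Walk (deleteEdge R c d) S a c ⊎ Walk (deleteEdge R c d) S a d
  beforeFirstUse c d ([] s) = inj₁ ([] s)
  beforeFirstUse {a = a} c d (_∷_ {b = b} (s , r) w) with onEdge? c d a b
  ... | yes (inj₁ (refl , refl)) = inj₂ (inj₁ ([] s))
  ... | yes (inj₂ (refl , refl)) = inj₂ (inj₂ ([] s))
  ... | no notOn with beforeFirstUse c d w
  ...   | inj₁ w′ = inj₁ ((s , r , notOn) ∷ w′)
  ...   | inj₂ (inj₁ w′) = inj₂ (inj₁ ((s , r , notOn) ∷ w′))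
  ...   | inj₂ (inj₂ w′) = inj₂ (inj₂ ((s , r , notOn) ∷ w′))

  exitArc : {P : Fin n → Set} → U.Decidable P → Walk R S a b → P a → ¬ P b →
            ∃ λ x → ∃ λ y → S x × S y × R x y × P x × ¬ P y
  exitArc P? ([] _) pa ¬pb = ⊥-elim (¬pb pa)
  exitArc {a = a} P? (_∷_ {b = b} (s , r) w) pa ¬pb with P? b
  ... | yes pb = exitArc P? w pb ¬pb
  ... | no ¬pb′ = a , b , s , start∈ w , r , pa , ¬pb′

  module _ (G : Digraph n) (S : Fin n → Set) where

    Avoiding : Fin n → Fin n → Fin n → Fin n → Set
    Avoiding u v = Walk (deleteEdge (UEdge G) u v) S

    avoiding-sym : Symmetric (deleteEdge (UEdge G) u v)
    avoiding-sym = deleteEdge-sym {R = UEdge G} swap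

    private
      underlying : Walk (deleteEdge (Edge G) u v) S a b → Avoiding u v a b
      underlying = mapʷ λ _ _ (e , notOn) → inj₁ e , notOn

      flipAvoiding : Walk (deleteEdge (Edge G) v u) S v u → Avoiding u v u v
      flipAvoiding =
        reverseʷ avoiding-sym ∘ mapʷ (λ _ _ → deleteEdge-swap {R = UEdge G}) ∘ underlying

    -- Twinless paths u → v and v → u cannot use (u,v) and (v,u) respectively,
    -- so cutting one of them at its last use of {u,v} gives a detour.
    detour : TwinlessStronglyConnected G S → S u → S v → Avoiding u v u v
    detour {u} {v} tsc su sv with tsc u v su sv
    ... | p , q , twinless with afterLastUse u v (walk p) | afterLastUse v u (walk q)
    ... | inj₁ w | _ = underlying w
    ... | inj₂ (inj₁ w) | _ = underlying w
    ... | inj₂ (inj₂ _) | inj₁ w = flipAvoiding w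
    ... | inj₂ (inj₂ _) | inj₂ (inj₁ w) = flipAvoiding w
    ... | inj₂ (inj₂ (uv∈p , _)) | inj₂ (inj₂ (vu∈q , _)) = ⊥-elim (twinless u v uv∈p vu∈q)

    avoidArc : TwinlessStronglyConnected G S → S u → S v →
               S x → S y → Edge G x y → Avoiding u v x y
    avoidArc {u} {v} {x} {y} tsc su sv sx sy e with onEdge? u v x y
    ... | no notOn = (sx , inj₁ e , notOn) ∷ [] sy
    ... | yes (inj₁ (refl , refl)) = detour tsc su sv
    ... | yes (inj₂ (refl , refl)) = reverseʷ avoiding-sym (detour tsc su sv)

    twinless⇒twoEdgeConnected : TwinlessStronglyConnected G S → TwoEdgeConnected S (UEdge G)
    twinless⇒twoEdgeConnected tsc =
        (λ a b sa sb → mapʷ (λ _ _ → inj₁) (directed a b sa sb))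
      , λ u v su sv _ a b sa sb → bindʷ (avoidArc tsc su sv) (directed a b sa sb)
      where
      directed : ∀ a b → S a → S b → Walk (Edge G) S a b
      directed a b sa sb = walk (proj₁ (tsc a b sa sb))

  deleteArc : Rel (Fin n) 0ℓ → Fin n → Fin n → Rel (Fin n) 0ℓ
  deleteArc R c d x y = R x y × ¬ (x ≡ c × y ≡ d)

  module Orientation (G : Digraph n) (S : Fin n → Set) (S? : U.Decidable S)
                     (twoEdge : TwoEdgeConnected S (UEdge G)) where

    record Admissible (R : Rel (Fin n) 0ℓ) : Set where
      field
        arc?     : Decidable R
        R⊆E      : ∀ {x y} → R x y → Edge G x y
        connects : ∀ a b → S a → S b → Walk R S a b
        covers   : ∀ {x y} → S x → S y → Edge G x y → R x y ⊎ R y x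
    open Admissible

    edges-admissible : StronglyConnected G S → Admissible (Edge G)
    edges-admissible sc = record
      { arc? = λ a b → adj G a b ≟ᵇ true
      ; R⊆E = id
      ; connects = λ a b sa sb → walk (sc a b sa sb)
      ; covers = λ _ _ → inj₁ }

    coversUnderlying : Admissible R → S x → S y → UEdge G x y → R x y ⊎ R y x
    coversUnderlying adm sx sy (inj₁ e) = covers adm sx sy e
    coversUnderlying adm sx sy (inj₂ e) = swap (covers adm sy sx e)

    -- The key consequence of 2-edge-connectivity: after deleting an edge {c,d}
    -- of an admissible R, one can still go from c to d or from d to c.
    -- Otherwise a c–d walk of the underlying graph minus {c,d} has an edge {x,y}
    -- leaving the set reachable from c; whichever of (x,y), (y,x) lies in R,
    -- strong connectivity of R routes around it, contradicting the choice.
    noBridge : Admissible R → S c → S d → Edge G c d →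
               ¬ Walk (deleteEdge R c d) S c d → ¬ Walk (deleteEdge R c d) S d c → ⊥
    noBridge {R} {c} {d} adm sc sd e no-cd no-dc
      with exitArc (walk? (deleteEdge? (arc? adm) c d) S? c)
                   (proj₂ twoEdge c d sc sd (inj₁ e) c d sc sd) ([] sc) no-cd
    ... | x , y , sx , sy , (uxy , notOn) , cx , ¬cy
      with coversUnderlying adm sx sy uxy
    ... | inj₁ rxy = ¬cy (cx ++ʷ ((sx , rxy , notOn) ∷ [] sy))
    ... | inj₂ ryx with afterLastUse c d (connects adm c y sc sy)
    ...   | inj₁ cy = ¬cy cy
    ...   | inj₂ (inj₁ cy) = ¬cy cy
    ...   | inj₂ (inj₂ (_ , dy)) with beforeFirstUse c d (connects adm x c sx sc)
    ...     | inj₁ xc = no-dc (dy ++ʷ ((sy , ryx , notOn ∘ onEdge-flip) ∷ xc))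
    ...     | inj₂ (inj₁ xc) = no-dc (dy ++ʷ ((sy , ryx , notOn ∘ onEdge-flip) ∷ xc))
    ...     | inj₂ (inj₂ xd) = no-cd (cx ++ʷ xd)

    deleteArc-admissible : Admissible R → R c d → R d c → Walk (deleteEdge R c d) S c d →
                           Admissible (deleteArc R c d)
    deleteArc-admissible {R} {c} {d} adm rcd rdc cd = record
      { arc? = λ x y → arc? adm x y ×-dec ¬? ((x ≟ c) ×-dec (y ≟ d))
      ; R⊆E = R⊆E adm ∘ proj₁
      ; connects = λ a b sa sb → bindʷ reroute (connects adm a b sa sb)
      ; covers = λ sx sy e → [ keep , swap ∘ keep ]′ (covers adm sx sy e) }
      where
      c≢d : c ≢ d
      c≢d refl = noLoop G c (R⊆E adm rcd)
      reroute : ∀ {x y} → S x → S y → R x y → Walk (deleteArc R c d) S x y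
      reroute {x} {y} sx sy r with (x ≟ c) ×-dec (y ≟ d)
      ... | yes (refl , refl) = mapʷ (λ _ _ (r′ , notOn) → r′ , notOn ∘ inj₁) cd
      ... | no notCD = (sx , r , notCD) ∷ [] sy
      keep : ∀ {x y} → R x y → deleteArc R c d x y ⊎ deleteArc R c d y x
      keep {x} {y} r with (x ≟ c) ×-dec (y ≟ d)
      ... | yes (refl , refl) = inj₂ (rdc , λ (d≡c , _) → c≢d (sym d≡c))
      ... | no notCD = inj₁ (r , notCD)

    Refinement : Rel (Fin n) 0ℓ → (Rel (Fin n) 0ℓ → Set) → Set₁
    Refinement R P =
      Σ (Rel (Fin n) 0ℓ) λ R′ → Admissible R′ × (∀ {x y} → R′ x y → R x y) × P R′

    NoTwin : Fin n → Fin n → Rel (Fin n) 0ℓ → Set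
    NoTwin c d R = S c → S d → ¬ (R c d × R d c)

    removeTwin : ∀ c d → Admissible R → Refinement R (NoTwin c d)
    removeTwin {R} c d adm with arc? adm c d ×-dec arc? adm d c
    ... | no noTwin = R , adm , id , λ _ _ → noTwin
    ... | yes (rcd , rdc) with S? c ×-dec S? d
    ...   | no outside = R , adm , id , λ sc sd _ → outside (sc , sd)
    ...   | yes (sc , sd) with walk? (deleteEdge? (arc? adm) c d) S? c d
    ...     | yes cd = deleteArc R c d , deleteArc-admissible adm rcd rdc cd , proj₁
                     , λ _ _ (r , _) → proj₂ r (refl , refl)
    ...     | no no-cd with walk? (deleteEdge? (arc? adm) c d) S? d c
    ...       | yes dc = deleteArc R d c
                       , deleteArc-admissible adm rdc rcd
                           (mapʷ (λ _ _ → deleteEdge-swap {R = R}) dc)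
                       , proj₁ , λ _ _ (_ , r) → proj₂ r (refl , refl)
    ...       | no no-dc = ⊥-elim (noBridge adm sc sd (R⊆E adm rcd) no-cd no-dc)

    NoTwinsOn : List (Fin n × Fin n) → Rel (Fin n) 0ℓ → Set
    NoTwinsOn pairs R = ∀ {c d} → (c , d) ∈ pairs → NoTwin c d R

    removeTwins : ∀ pairs → Admissible R → Refinement R (NoTwinsOn pairs)
    removeTwins [] adm = _ , adm , id , λ ()
    removeTwins ((c , d) ∷ pairs) adm with removeTwin c d adm
    ... | R₁ , adm₁ , R₁⊆R , noTwin₁ with removeTwins pairs adm₁
    ...   | R₂ , adm₂ , R₂⊆R₁ , noTwins₂ = R₂ , adm₂ , R₁⊆R ∘ R₂⊆R₁ , noTwins
      where
      noTwins : NoTwinsOn ((c , d) ∷ pairs) R₂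
      noTwins (here refl) sc sd (rcd , rdc) = noTwin₁ sc sd (R₂⊆R₁ rcd , R₂⊆R₁ rdc)
      noTwins (there cd∈pairs) = noTwins₂ cd∈pairs

    pathWithin : Admissible R → S a → S b →
      Σ (Path (Edge G) S a b) λ p →
        ∀ {c d} → (c , d) ∈ edges (walk p) → S c × R c d × S d
    pathWithin {R} adm sa sb with toPath (connects adm _ _ sa sb)
    ... | path w unique = path (mapʷ toE w) (subst Unique (sym (vertices-mapʷ toE w)) unique)
                        , λ cd∈ → edge-inside w (subst (_ ∈_) (edges-mapʷ toE w) cd∈)
      where
      toE : ∀ {x y} → S x → S y → R x y → Edge G x y
      toE _ _ = R⊆E adm

    -- Breaking up all antiparallel pairs leaves an admissible R; paths of G
    -- inside R are twinless, since R has no arc together with its reverse.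
    twinless : StronglyConnected G S → TwinlessStronglyConnected G S
    twinless sc a b sa sb
      with removeTwins (cartesianProduct (allFin n) (allFin n)) (edges-admissible sc)
    ... | R , adm , _ , noTwins with pathWithin adm sa sb | pathWithin adm sb sa
    ... | p , p⊆R | q , q⊆R = p , q , λ c d cd∈p dc∈q →
      let (sc , rcd , sd) = p⊆R cd∈p ; (_ , rdc , _) = q⊆R dc∈q
      in noTwins (∈-cartesianProduct⁺ (∈-allFin c) (∈-allFin d)) sc sd (rcd , rdc)

  twinless⇔strong×twoEdge : (G : Digraph n) → U.Decidable S →
    TwinlessStronglyConnected G S ⇔ (StronglyConnected G S × TwoEdgeConnected S (UEdge G))
  twinless⇔strong×twoEdge {S = S} G S? = mk⇔
    (λ tsc → (λ a b sa sb → proj₁ (tsc a b sa sb)) , twinless⇒twoEdgeConnected G S tsc)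
    (λ (sc , twoEdge) → Orientation.twinless G S S? twoEdge sc)

-- Instantiating the characterisation with S = V ∖ {y}; deciding strong
-- connectivity of V ∖ {y} separates the two cases of T^ap.
mainTheorem1 : ∀ {n : ℕ} (G : Digraph n) → StronglyConnected G allV →
    (y : Fin n) → TwinlessArticulationPoint G y ⇔ InTap G y
mainTheorem1 G _ y = mk⇔ toTap fromTap
  where
  S? : U.Decidable (minus y)
  S? a = ¬? (a ≟ y)
  open Equivalence (twinless⇔strong×twoEdge G S?) renaming (to to split; from to combine)
  toTap : TwinlessArticulationPoint G y → InTap G y
  toTap notTwinless with stronglyConnected? G S?
  ... | yes sc = inj₂ ((λ sap → sap sc) , λ twoEdge → notTwinless (combine (sc , twoEdge)))
  ... | no notStrong = inj₁ notStrong
  fromTap : InTap G y → TwinlessArticulationPoint G y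
  fromTap (inj₁ sap) tsc = sap (proj₁ (split tsc))
  fromTap (inj₂ (_ , notTwoEdge)) tsc = notTwoEdge (proj₂ (split tsc))
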